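{- Let $D$ be a rectangular design with parameters $v=mn,b,r,k,\lambda_1,\lambda_2,\lambda_3,m,n$, and let $\theta_1=r-\lambda_1+(m-1)(\lambda_2-\lambda_3)$, $\theta_2=r-\lambda_2+(n-1)(\lambda_1-\lambda_3)$, $\theta_3=r-\lambda_1-\lambda_2+\lambda_3$. Then: (a) If $D$ is semi-regular (i.e. either $\theta_1=0<\theta_2,\theta_3$, or $\theta_2=0<\theta_1,\theta_3$), then at least one of $\lambda_3-\lambda_1$, $\lambda_3-\lambda_2$ is positive. (b) If $D$ is Latin regular (i.e. $\theta_1=\theta_2>0$ and $\theta_3>0$) and one of $\lambda_3-\lambda_1$, $\lambda_3-\lambda_2$ is positive, then the other is also positive. (c) If $D$ is Latin semi-regular (i.e. $\theta_1=\theta_2=0<\theta_3$), then both $\lambda_3-\lambda_1$ and $\lambda_3-\lambda_2$ are positive. (d) If $D$ is singular (i.e. $\theta_3=0$), then neither $\lambda_3-\lambda_1$ nor $\lambda_3-\lambda_2$ is positive.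
   Context: Let $m,n$ be positive integers and arrange $v=mn$ treatments in an $m\times n$ array $A$ (row $i$ consists of treatments $(i-1)n+1,\dots,in$). A rectangular design (RD) with parameters $v=mn,b,r,k,\lambda_1,\lambda_2,\lambda_3,m,n$ is a collection of $b$ blocks, each a set of $k$ distinct treatments, such that every treatment lies in exactly $r$ blocks, any two distinct treatments in the same row of $A$ occur together in exactly $\lambda_1$ blocks, any two distinct treatments in the same column of $A$ occur together in exactly $\lambda_2$ blocks, and any other two distinct treatments occur together in exactly $\lambda_3$ blocks. The numbers $\theta_1,\theta_2,\theta_3$ are the eigenvalues of $NN^T$ ($N$ the $v\times b$ incidence matrix), with multiplicities $n-1,m-1,(m-1)(n-1)$. -}

module Defs where

open import Data.Nat using (ℕ; suc)
open import Data.Fin using (Fin)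
open import Data.Fin.Properties as FinP using ()
open import Data.Product using (_×_; _,_; proj₁; proj₂)
open import Data.Product.Properties using (≡-dec)
open import Data.List using (List; length; filter)
open import Data.List.Relation.Unary.Unique.Propositional using (Unique)
open import Data.List.Membership.Propositional using (_∈_)
open import Relation.Nullary using (¬_)
open import Relation.Nullary.Decidable using (_×-dec_)
open import Relation.Binary.PropositionalEquality using (_≡_; _≢_)
open import Data.Integer as ℤ using (ℤ; +_)

Treatment : ℕ → ℕ → Set
Treatment m n = Fin m × Fin n

-- A block is a list of treatments (distinctness is imposed in the design).
Block : ℕ → ℕ → Set
Block m n = List (Treatment m n)

_≟T_ : ∀ {m n} (x y : Treatment m n) → Relation.Nullary.Dec (x ≡ y)
_≟T_ = ≡-dec FinP._≟_ FinP._≟_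

import Data.List.Membership.DecPropositional as DecMem

_∈?_ : ∀ {m n} (x : Treatment m n) (B : Block m n) → Relation.Nullary.Dec (x ∈ B)
_∈?_ {m} {n} = DecMem._∈?_ (_≟T_ {m} {n})

rep : ∀ {m n} → List (Block m n) → Treatment m n → ℕ
rep Bs x = length (filter (λ B → x ∈? B) Bs)

conc : ∀ {m n} → List (Block m n) → Treatment m n → Treatment m n → ℕ
conc Bs x y = length (filter (λ B → (x ∈? B) ×-dec (y ∈? B)) Bs)

record RectangularDesign (m n b r k λ₁ λ₂ λ₃ : ℕ) : Set where
  field
    blocks      : List (Block m n)
    numBlocks   : length blocks ≡ b
    distinct    : ∀ {B} → B ∈ blocks → Unique B
    blockSize   : ∀ {B} → B ∈ blocks → length B ≡ k
    replication : ∀ x → rep blocks x ≡ r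
    sameRow     : ∀ x y → x ≢ y → proj₁ x ≡ proj₁ y → conc blocks x y ≡ λ₁
    sameCol     : ∀ x y → x ≢ y → proj₂ x ≡ proj₂ y → conc blocks x y ≡ λ₂
    other       : ∀ x y → proj₁ x ≢ proj₁ y → proj₂ x ≢ proj₂ y → conc blocks x y ≡ λ₃

θ₁ θ₂ θ₃ : (m n r λ₁ λ₂ λ₃ : ℕ) → ℤ
θ₁ m n r λ₁ λ₂ λ₃ = (+ r ℤ.- + λ₁) ℤ.+ (+ m ℤ.- ℤ.1ℤ) ℤ.* (+ λ₂ ℤ.- + λ₃)
θ₂ m n r λ₁ λ₂ λ₃ = (+ r ℤ.- + λ₂) ℤ.+ (+ n ℤ.- ℤ.1ℤ) ℤ.* (+ λ₁ ℤ.- + λ₃)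
θ₃ m n r λ₁ λ₂ λ₃ = ((+ r ℤ.- + λ₁) ℤ.- + λ₂) ℤ.+ + λ₃

-- Parts (a)–(c) are linear algebra in the parameters: θ₃ − θ₁ = m(λ₃ − λ₂) and
-- θ₃ − θ₂ = n(λ₃ − λ₁), so λ₃ − λ₂ and λ₃ − λ₁ have the signs of θ₃ − θ₁ and θ₃ − θ₂.
-- Part (d) is a counting argument: take x, y in one row and z, w below them in the same
-- columns. Every block B satisfies
--   [x, w ∈ B] − [x, z ∈ B] ≤ ([x ∈ B] − [y ∈ B] − [z ∈ B] + [w ∈ B])²,
-- and summing over the blocks gives λ₃ − λ₂ ≤ 4θ₃; transposing, λ₃ − λ₁ ≤ 4θ₃.
module Submission where

open import Defs
open import Data.Nat using (ℕ; _≤_)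
open import Data.Product using (_×_)
open import Data.Sum using (_⊎_)
open import Relation.Nullary using (¬_)
open import Relation.Binary.PropositionalEquality using (_≡_)
open import Data.Integer using (ℤ; +_; _-_; _<_; 0ℤ)

open import Level using (Level)
open import Function using (_∘_)
open import Function.Bundles using (_⇔_; mk⇔; module Equivalence)
open import Data.Bool.Base using (Bool; true; false; _∧_; if_then_else_)
open import Data.Fin.Base using (zero; suc)
open import Data.List.Base using (List; []; _∷_; length; filter)
open import Data.Product using (_,_)
open import Data.Sum using (inj₁; inj₂)
open import Data.Nat using (_+_; _*_; suc; z≤n; s≤s)
import Data.Nat.Properties as ℕ
import Data.Integer as ℤ
import Data.Integer.Properties as ℤ
import Data.Nat.Tactic.RingSolver as ℕ-Solver
import Data.Integer.Tactic.RingSolver as ℤ-Solver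
open import Relation.Nullary using (does)
open import Relation.Nullary.Decidable using (_×-dec_)
open import Relation.Unary using (Pred; Decidable)
open import Relation.Binary.PropositionalEquality
  using (refl; sym; trans; cong; cong₂; subst; subst₂)

private variable
  a ℓ : Level
  A : Set a

indicator : Bool → ℕ
indicator b = if b then 1 else 0

count : (A → Bool) → List A → ℕ
count f []       = 0
count f (x ∷ xs) = indicator (f x) + count f xs

length-filter≡count : {P : Pred A ℓ} (P? : Decidable P) (xs : List A) →
                      length (filter P? xs) ≡ count (does ∘ P?) xs
length-filter≡count P? []       = refl
length-filter≡count P? (x ∷ xs) with does (P? x)
... | true  = cong suc (length-filter≡count P? xs)
... | false = length-filter≡count P? xs

-- [p ∧ t] − [p ∧ s] ≤ ([p] − [q] − [s] + [t])², expanded so that no subtraction occurs.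
indicator-bound : ∀ p q s t →
  indicator (p ∧ t) + 2 * (indicator (p ∧ q) + indicator (p ∧ s) + indicator (q ∧ t) + indicator (s ∧ t))
    ≤ indicator (p ∧ s) + (indicator p + indicator q + indicator s + indicator t)
      + 2 * (indicator (p ∧ t) + indicator (q ∧ s))
indicator-bound true  true  true  true  = ℕ.≤ᵇ⇒≤ _ _ _
indicator-bound true  true  true  false = ℕ.≤ᵇ⇒≤ _ _ _
indicator-bound true  true  false true  = ℕ.≤ᵇ⇒≤ _ _ _
indicator-bound true  true  false false = ℕ.≤ᵇ⇒≤ _ _ _
indicator-bound true  false true  true  = ℕ.≤ᵇ⇒≤ _ _ _
indicator-bound true  false true  false = ℕ.≤ᵇ⇒≤ _ _ _
indicator-bound true  false false true  = ℕ.≤ᵇ⇒≤ _ _ _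
indicator-bound true  false false false = ℕ.≤ᵇ⇒≤ _ _ _
indicator-bound false true  true  true  = ℕ.≤ᵇ⇒≤ _ _ _
indicator-bound false true  true  false = ℕ.≤ᵇ⇒≤ _ _ _
indicator-bound false true  false true  = ℕ.≤ᵇ⇒≤ _ _ _
indicator-bound false true  false false = ℕ.≤ᵇ⇒≤ _ _ _
indicator-bound false false true  true  = ℕ.≤ᵇ⇒≤ _ _ _
indicator-bound false false true  false = ℕ.≤ᵇ⇒≤ _ _ _
indicator-bound false false false true  = ℕ.≤ᵇ⇒≤ _ _ _
indicator-bound false false false false = ℕ.≤ᵇ⇒≤ _ _ _

module _ (p q s t : A → Bool) where

  private
    p∧q p∧s p∧t q∧s q∧t s∧t : A → Bool
    p∧q x = p x ∧ q x
    p∧s x = p x ∧ s x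
    p∧t x = p x ∧ t x
    q∧s x = q x ∧ s x
    q∧t x = q x ∧ t x
    s∧t x = s x ∧ t x

  count-bound : ∀ xs →
    count p∧t xs + 2 * (count p∧q xs + count p∧s xs + count q∧t xs + count s∧t xs)
      ≤ count p∧s xs + (count p xs + count q xs + count s xs + count t xs)
        + 2 * (count p∧t xs + count q∧s xs)
  count-bound []       = z≤n
  count-bound (x ∷ xs) = subst₂ _≤_
    (split-lhs (ι p∧t) (ι p∧q) (ι p∧s) (ι q∧t) (ι s∧t) (κ p∧t) (κ p∧q) (κ p∧s) (κ q∧t) (κ s∧t))
    (split-rhs (ι p∧s) (ι p) (ι q) (ι s) (ι t) (ι p∧t) (ι q∧s)
               (κ p∧s) (κ p) (κ q) (κ s) (κ t) (κ p∧t) (κ q∧s))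
    (ℕ.+-mono-≤ (indicator-bound (p x) (q x) (s x) (t x)) (count-bound xs))
    where
    ι κ : (A → Bool) → ℕ
    ι f = indicator (f x)
    κ f = count f xs
    split-lhs : ∀ a b c d e a′ b′ c′ d′ e′ →
      (a + 2 * (b + c + d + e)) + (a′ + 2 * (b′ + c′ + d′ + e′))
        ≡ (a + a′) + 2 * ((b + b′) + (c + c′) + (d + d′) + (e + e′))
    split-lhs = ℕ-Solver.solve-∀
    split-rhs : ∀ a b c d e f g a′ b′ c′ d′ e′ f′ g′ →
      (a + (b + c + d + e) + 2 * (f + g)) + (a′ + (b′ + c′ + d′ + e′) + 2 * (f′ + g′))
        ≡ (a + a′) + ((b + b′) + (c + c′) + (d + d′) + (e + e′)) + 2 * ((f + f′) + (g + g′))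
    split-rhs = ℕ-Solver.solve-∀

four-point-bound : ∀ {m n} (Bs : List (Block m n)) {x y z w r α β γ} →
  (∀ u → rep Bs u ≡ r) →
  conc Bs x y ≡ α → conc Bs z w ≡ α → conc Bs x z ≡ β → conc Bs y w ≡ β →
  conc Bs x w ≡ γ → conc Bs y z ≡ γ →
  γ + 4 * (α + β) ≤ β + 4 * (r + γ)
four-point-bound {m} {n} Bs {x} {y} {z} {w} {r} {α} {β} {γ} rep≡r xy zw xz yw xw yz = begin
  γ + 4 * (α + β)                    ≡⟨ collectˡ γ α β ⟩
  γ + 2 * (α + β + β + α)
    ≡⟨ cong₂ _+_ (#≡ xw) (cong (2 *_) (cong₂ _+_ (cong₂ _+_ (cong₂ _+_ (#≡ xy) (#≡ xz)) (#≡ yw)) (#≡ zw))) ⟨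
  _ ≤⟨ count-bound (∈B x) (∈B y) (∈B z) (∈B w) Bs ⟩
  _ ≡⟨ cong₂ _+_ (cong₂ _+_ (#≡ xz) (cong₂ _+_ (cong₂ _+_ (cong₂ _+_ (#r x) (#r y)) (#r z)) (#r w)))
                 (cong (2 *_) (cong₂ _+_ (#≡ xw) (#≡ yz))) ⟩
  β + (r + r + r + r) + 2 * (γ + γ)  ≡⟨ collectʳ β r γ ⟩
  β + 4 * (r + γ)                    ∎
  where
  open ℕ.≤-Reasoning
  ∈B : Treatment m n → Block m n → Bool
  ∈B u B = does (u ∈? B)
  #≡ : ∀ {u v c} → conc Bs u v ≡ c → count (λ B → ∈B u B ∧ ∈B v B) Bs ≡ c
  #≡ {u} {v} = trans (sym (length-filter≡count (λ B → (u ∈? B) ×-dec (v ∈? B)) Bs))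
  #r : ∀ u → count (∈B u) Bs ≡ r
  #r u = trans (sym (length-filter≡count (u ∈?_) Bs)) (rep≡r u)
  collectˡ : ∀ γ α β → γ + 4 * (α + β) ≡ γ + 2 * (α + β + β + α)
  collectˡ = ℕ-Solver.solve-∀
  collectʳ : ∀ β r γ → β + (r + r + r + r) + 2 * (γ + γ) ≡ β + 4 * (r + γ)
  collectʳ = ℕ-Solver.solve-∀

≤-cancel-singular : ∀ {r s γ μ} → r + γ ≡ s → γ + 4 * s ≤ μ + 4 * (r + γ) → γ ≤ μ
≤-cancel-singular {s = s} {γ} {μ} r+γ≡s le =
  ℕ.+-cancelʳ-≤ (4 * s) γ μ (subst (λ c → γ + 4 * s ≤ μ + 4 * c) r+γ≡s le)

-- λ₃ − λ₂ ≤ 4θ₃ and λ₃ − λ₁ ≤ 4θ₃, with θ₃ expanded and the subtractions moved across.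
module _ {m n b r k λ₁ λ₂ λ₃ : ℕ} (D : RectangularDesign (2 + m) (2 + n) b r k λ₁ λ₂ λ₃) where

  open RectangularDesign D

  private
    x y z w : Treatment (2 + m) (2 + n)
    x = zero , zero
    y = zero , suc zero
    z = suc zero , zero
    w = suc zero , suc zero

  λ₃-λ₂≤4θ₃ : λ₃ + 4 * (λ₁ + λ₂) ≤ λ₂ + 4 * (r + λ₃)
  λ₃-λ₂≤4θ₃ = four-point-bound blocks replication
    (sameRow x y (λ ()) refl) (sameRow z w (λ ()) refl)
    (sameCol x z (λ ()) refl) (sameCol y w (λ ()) refl)
    (other x w (λ ()) (λ ())) (other y z (λ ()) (λ ()))

  λ₃-λ₁≤4θ₃ : λ₃ + 4 * (λ₂ + λ₁) ≤ λ₁ + 4 * (r + λ₃)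
  λ₃-λ₁≤4θ₃ = four-point-bound blocks replication
    (sameCol x z (λ ()) refl) (sameCol y w (λ ()) refl)
    (sameRow x y (λ ()) refl) (sameRow z w (λ ()) refl)
    (other x w (λ ()) (λ ())) (other z y (λ ()) (λ ()))

  singular⇒λ₃≤λ₂ : r + λ₃ ≡ λ₁ + λ₂ → λ₃ ≤ λ₂
  singular⇒λ₃≤λ₂ r+λ₃≡λ₁+λ₂ = ≤-cancel-singular r+λ₃≡λ₁+λ₂ λ₃-λ₂≤4θ₃

  singular⇒λ₃≤λ₁ : r + λ₃ ≡ λ₁ + λ₂ → λ₃ ≤ λ₁
  singular⇒λ₃≤λ₁ r+λ₃≡λ₁+λ₂ = ≤-cancel-singular (trans r+λ₃≡λ₁+λ₂ (ℕ.+-comm λ₁ λ₂)) λ₃-λ₁≤4θ₃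

θ₃≡0⇒r+λ₃≡λ₁+λ₂ : ∀ m n r λ₁ λ₂ λ₃ → θ₃ m n r λ₁ λ₂ λ₃ ≡ 0ℤ → r + λ₃ ≡ λ₁ + λ₂
θ₃≡0⇒r+λ₃≡λ₁+λ₂ m n r λ₁ λ₂ λ₃ θ₃≡0 =
  ℤ.+-injective (ℤ.i-j≡0⇒i≡j _ _ (trans (sym (θ₃-regroup (+ r) (+ λ₁) (+ λ₂) (+ λ₃))) θ₃≡0))
  where
  θ₃-regroup : ∀ (r λ₁ λ₂ λ₃ : ℤ) → ((r - λ₁) - λ₂) ℤ.+ λ₃ ≡ (r ℤ.+ λ₃) - (λ₁ ℤ.+ λ₂)
  θ₃-regroup = ℤ-Solver.solve-∀

m[λ₃-λ₂]≡θ₃-θ₁ : ∀ m n r λ₁ λ₂ λ₃ →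
  + m ℤ.* (+ λ₃ - + λ₂) ≡ θ₃ m n r λ₁ λ₂ λ₃ - θ₁ m n r λ₁ λ₂ λ₃
m[λ₃-λ₂]≡θ₃-θ₁ m n r λ₁ λ₂ λ₃ = identity (+ m) (+ r) (+ λ₁) (+ λ₂) (+ λ₃)
  where
  identity : ∀ (m r λ₁ λ₂ λ₃ : ℤ) → m ℤ.* (λ₃ - λ₂)
    ≡ (((r - λ₁) - λ₂) ℤ.+ λ₃) - ((r - λ₁) ℤ.+ (m - ℤ.1ℤ) ℤ.* (λ₂ - λ₃))
  identity = ℤ-Solver.solve-∀

n[λ₃-λ₁]≡θ₃-θ₂ : ∀ m n r λ₁ λ₂ λ₃ →
  + n ℤ.* (+ λ₃ - + λ₁) ≡ θ₃ m n r λ₁ λ₂ λ₃ - θ₂ m n r λ₁ λ₂ λ₃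
n[λ₃-λ₁]≡θ₃-θ₂ m n r λ₁ λ₂ λ₃ = identity (+ n) (+ r) (+ λ₁) (+ λ₂) (+ λ₃)
  where
  identity : ∀ (n r λ₁ λ₂ λ₃ : ℤ) → n ℤ.* (λ₃ - λ₁)
    ≡ (((r - λ₁) - λ₂) ℤ.+ λ₃) - ((r - λ₂) ℤ.+ (n - ℤ.1ℤ) ℤ.* (λ₁ - λ₃))
  identity = ℤ-Solver.solve-∀

0<[1+k]*i⇔0<i : ∀ k {i} → 0ℤ < + suc k ℤ.* i ⇔ 0ℤ < i
0<[1+k]*i⇔0<i k {i} = mk⇔
  (ℤ.*-cancelˡ-<-nonNeg (+ suc k) ∘ subst (_< + suc k ℤ.* i) (sym (ℤ.*-zeroʳ (+ suc k))))
  (subst (_< + suc k ℤ.* i) (ℤ.*-zeroʳ (+ suc k)) ∘ ℤ.*-monoˡ-<-pos (+ suc k))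

j≡0⇒0<i⇒0<i-j : ∀ {i j} → j ≡ 0ℤ → 0ℤ < i → 0ℤ < i - j
j≡0⇒0<i⇒0<i-j {i} refl = subst (0ℤ <_) (sym (ℤ.+-identityʳ i))

≤⇒0≮m-n : ∀ {m n} → m ≤ n → ¬ (0ℤ < + m - + n)
≤⇒0≮m-n = ℤ.≤⇒≯ ∘ ℤ.i≤j⇒i-j≤0 ∘ ℤ.+≤+

proposition2 : ∀ (m n b r k λ₁ λ₂ λ₃ : ℕ) → 2 ≤ m → 2 ≤ n
    → RectangularDesign m n b r k λ₁ λ₂ λ₃
    → ((θ₁ m n r λ₁ λ₂ λ₃ ≡ 0ℤ × 0ℤ < θ₂ m n r λ₁ λ₂ λ₃ × 0ℤ < θ₃ m n r λ₁ λ₂ λ₃)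
         ⊎ (θ₂ m n r λ₁ λ₂ λ₃ ≡ 0ℤ × 0ℤ < θ₁ m n r λ₁ λ₂ λ₃ × 0ℤ < θ₃ m n r λ₁ λ₂ λ₃)
       → (0ℤ < + λ₃ - + λ₁) ⊎ (0ℤ < + λ₃ - + λ₂))
      × (θ₁ m n r λ₁ λ₂ λ₃ ≡ θ₂ m n r λ₁ λ₂ λ₃ → 0ℤ < θ₁ m n r λ₁ λ₂ λ₃ → 0ℤ < θ₃ m n r λ₁ λ₂ λ₃
       → ((0ℤ < + λ₃ - + λ₁ → 0ℤ < + λ₃ - + λ₂) × (0ℤ < + λ₃ - + λ₂ → 0ℤ < + λ₃ - + λ₁)))
      × (θ₁ m n r λ₁ λ₂ λ₃ ≡ 0ℤ → θ₂ m n r λ₁ λ₂ λ₃ ≡ 0ℤ → 0ℤ < θ₃ m n r λ₁ λ₂ λ₃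
       → (0ℤ < + λ₃ - + λ₁) × (0ℤ < + λ₃ - + λ₂))
      × (θ₃ m n r λ₁ λ₂ λ₃ ≡ 0ℤ
       → ¬ (0ℤ < + λ₃ - + λ₁) × ¬ (0ℤ < + λ₃ - + λ₂))
proposition2 m@(suc (suc m′)) n@(suc (suc n′)) b r k λ₁ λ₂ λ₃ (s≤s (s≤s _)) (s≤s (s≤s _)) D =
    (λ { (inj₁ (θ₁≡0 , _ , 0<θ₃)) → inj₂ (to 0<θ₃-θ₁⇔0<λ₃-λ₂ (j≡0⇒0<i⇒0<i-j θ₁≡0 0<θ₃))
       ; (inj₂ (θ₂≡0 , _ , 0<θ₃)) → inj₁ (to 0<θ₃-θ₂⇔0<λ₃-λ₁ (j≡0⇒0<i⇒0<i-j θ₂≡0 0<θ₃)) })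
  , (λ θ₁≡θ₂ _ _ →
        to 0<θ₃-θ₁⇔0<λ₃-λ₂ ∘ subst (λ θ → 0ℤ < θ[ θ₃ ] - θ) (sym θ₁≡θ₂) ∘ from 0<θ₃-θ₂⇔0<λ₃-λ₁
      , to 0<θ₃-θ₂⇔0<λ₃-λ₁ ∘ subst (λ θ → 0ℤ < θ[ θ₃ ] - θ) θ₁≡θ₂ ∘ from 0<θ₃-θ₁⇔0<λ₃-λ₂)
  , (λ θ₁≡0 θ₂≡0 0<θ₃ →
        to 0<θ₃-θ₂⇔0<λ₃-λ₁ (j≡0⇒0<i⇒0<i-j θ₂≡0 0<θ₃) , to 0<θ₃-θ₁⇔0<λ₃-λ₂ (j≡0⇒0<i⇒0<i-j θ₁≡0 0<θ₃))
  , (λ θ₃≡0 → let r+λ₃≡λ₁+λ₂ = θ₃≡0⇒r+λ₃≡λ₁+λ₂ m n r λ₁ λ₂ λ₃ θ₃≡0 in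
        ≤⇒0≮m-n (singular⇒λ₃≤λ₁ D r+λ₃≡λ₁+λ₂) , ≤⇒0≮m-n (singular⇒λ₃≤λ₂ D r+λ₃≡λ₁+λ₂))
  where
  θ[_] : (ℕ → ℕ → ℕ → ℕ → ℕ → ℕ → ℤ) → ℤ
  θ[ θ ] = θ m n r λ₁ λ₂ λ₃
  open Equivalence using (to; from)
  0<θ₃-θ₁⇔0<λ₃-λ₂ : 0ℤ < θ[ θ₃ ] - θ[ θ₁ ] ⇔ 0ℤ < + λ₃ - + λ₂
  0<θ₃-θ₁⇔0<λ₃-λ₂ = subst (λ i → 0ℤ < i ⇔ 0ℤ < + λ₃ - + λ₂)
    (m[λ₃-λ₂]≡θ₃-θ₁ m n r λ₁ λ₂ λ₃) (0<[1+k]*i⇔0<i (suc m′))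
  0<θ₃-θ₂⇔0<λ₃-λ₁ : 0ℤ < θ[ θ₃ ] - θ[ θ₂ ] ⇔ 0ℤ < + λ₃ - + λ₁
  0<θ₃-θ₂⇔0<λ₃-λ₁ = subst (λ i → 0ℤ < i ⇔ 0ℤ < + λ₃ - + λ₁)
    (n[λ₃-λ₁]≡θ₃-θ₂ m n r λ₁ λ₂ λ₃) (0<[1+k]*i⇔0<i (suc n′))
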